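{- Let $G$ be a finite non-cyclic abelian group. Then $\kappa(\mathcal{P}(G))=1$ if and only if $G$ is a $p$-group for some prime $p$.
   Context: For a finite group $G$, the power graph $\mathcal{P}(G)$ is the simple graph with vertex set $G$ in which two distinct vertices $u,v$ are adjacent iff $u^m=v$ or $v^m=u$ for some $m\in\mathbb{N}$. For a graph $\Gamma$, the vertex connectivity $\kappa(\Gamma)$ is the minimum number of vertices whose removal leaves an induced subgraph that is disconnected. A $p$-group is a group of order $p^r$, $r\in\mathbb{N}$. -}

module Defs where

open import Data.Nat using (ℕ; zero; suc; _<_; _≥_; _^_)
open import Data.Nat.Primality using (Prime)
open import Data.Fin using (Fin)
open import Data.Fin.Subset using (Subset; _∈_; _∉_; ∣_∣)
open import Data.Product using (Σ; ∃; ∃-syntax; _×_; _,_)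
open import Data.Sum using (_⊎_)
open import Relation.Nullary using (¬_)
open import Relation.Binary.PropositionalEquality using (_≡_; _≢_)

-- A finite group of order n, presented on the carrier Fin n
-- (every finite group is isomorphic to one of this form).
record FinGroup (n : ℕ) : Set where
  field
    _∙_      : Fin n → Fin n → Fin n
    ε        : Fin n
    _⁻¹      : Fin n → Fin n
    assoc    : ∀ x y z → (x ∙ y) ∙ z ≡ x ∙ (y ∙ z)
    identityˡ : ∀ x → ε ∙ x ≡ x
    identityʳ : ∀ x → x ∙ ε ≡ x
    inverseˡ : ∀ x → (x ⁻¹) ∙ x ≡ ε
    inverseʳ : ∀ x → x ∙ (x ⁻¹) ≡ ε

module _ {n : ℕ} (G : FinGroup n) where
  open FinGroup G

  pow : Fin n → ℕ → Fin n
  pow x zero    = ε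
  pow x (suc m) = x ∙ pow x m

  IsAbelian : Set
  IsAbelian = ∀ x y → x ∙ y ≡ y ∙ x

  IsCyclic : Set
  IsCyclic = ∃[ g ] (∀ x → ∃[ m ] pow g m ≡ x)

  PowerAdj : Fin n → Fin n → Set
  PowerAdj u v = u ≢ v × ((∃[ m ] pow u m ≡ v) ⊎ (∃[ m ] pow v m ≡ u))

module _ {n : ℕ} (Adj : Fin n → Fin n → Set) where

  data PathAvoiding (S : Subset n) : Fin n → Fin n → Set where
    here : ∀ {u} → u ∉ S → PathAvoiding S u u
    step : ∀ {u w v} → u ∉ S → Adj u w → PathAvoiding S w v → PathAvoiding S u v

  DisconnectedAfterRemoving : Subset n → Set
  DisconnectedAfterRemoving S =
    ∃[ u ] ∃[ v ] (u ∉ S × v ∉ S × ¬ PathAvoiding S u v)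

  VertexConnectivityIs : ℕ → Set
  VertexConnectivityIs k =
    (∃[ S ] (∣ S ∣ ≡ k × DisconnectedAfterRemoving S))
    × (∀ S → ∣ S ∣ < k → ¬ DisconnectedAfterRemoving S)

IsPGroupOrder : ℕ → Set
IsPGroupOrder n = ∃[ p ] ∃[ r ] (Prime p × r ≥ 1 × n ≡ p ^ r)

module Submission where

-- Since ε = x ^ 0 is adjacent to every vertex, P(G) stays connected after
-- removing any set not containing ε; so κ ≥ 1, and κ = 1 iff removing ε alone
-- disconnects P(G).
--   * If two distinct primes p, q divide |G|, Cauchy's theorem gives elements a, c
--     of orders p, q.  Elements z, w of distinct prime orders are both powers of
--     z ∙ w, and every x ≠ ε has a power of prime order; so every x ≠ ε is joined
--     to a avoiding ε, and ε is not a cut vertex.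
--   * If |G| = p ^ r and G is not cyclic, pick a of order p inside a cyclic
--     subgroup of maximal order and b of order p outside it.  As a cyclic group has
--     a unique subgroup of order p, "a is a power of x" is invariant along paths
--     avoiding ε; it holds at a but not at b, so ε is a cut vertex.

open import Defs
open import Data.Nat using (ℕ; zero; suc; pred; nonTrivial⇒n>1; _+_; _*_; _∸_; _^_; _≤_; _<_; z≤n; s≤s; s≤s⁻¹; NonZero; ≢-nonZero)
open import Data.Nat.Properties
open import Data.Nat.DivMod using (_%_; _/_; m≡m%n+[m/n]*n; m%n<n)
open import Data.Nat.Divisibility using (_∣_; divides; _∣?_; ∣-trans; m∣m*n; ∣n⇒∣m*n; *-cancelʳ-∣; m%n≡0⇒n∣m; ∣1⇒≡1; _∣0)
open import Data.Nat.Primality using (Prime; prime⇒irreducible; prime⇒nonZero; prime⇒nonTrivial; euclidsLemma; ¬prime[1])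
open import Data.Nat.Primality.Factorisation using (factorise)
open import Data.Nat.Coprimality using (Coprime; coprime-Bézout; coprime-divisor)
open import Data.Nat.GCD using (module Bézout)
open import Data.Nat.ListAction using (product)
open import Data.List using (List; []; _∷_; length)
open import Data.List.Relation.Unary.All using (All; _∷_)
open import Data.Fin using (Fin; toℕ; fromℕ<) renaming (zero to fzero; suc to fsuc)
open import Data.Fin.Properties using (¬Fin0; any?; all?; ¬∀⟶∃¬; toℕ-fromℕ<) renaming (_≟_ to _≟ᶠ_)
open import Data.Fin.Permutation using (Permutation; permutation)
open import Data.Fin.Subset using (Subset; _∈_; _∉_; ∣_∣; ⁅_⁆)
open import Data.Fin.Subset.Properties using (x∈p∧x≢y⇒x∈p-y; x∈p⇒∣p-x∣<∣p∣; _∈?_; x≢y⇒x∉⁅y⁆; x∉⁅y⁆⇒x≢y; ∣⁅x⁆∣≡1)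
open import Data.Product using (∃; _×_; _,_; proj₁; proj₂)
open import Data.Sum using (_⊎_; inj₁; inj₂; swap)
open import Data.Empty using (⊥; ⊥-elim)
open import Data.Bool using (Bool; true; false; _∨_; _∧_)
open import Data.Bool.Properties using (∨-zeroʳ; ¬-not) renaming (_≟_ to _≟ᵇ_)
open import Function using (case_of_)
open import Function.Bundles using (_⇔_; mk⇔)
open import Relation.Nullary using (¬_; Dec; yes; no; does)
open import Relation.Nullary.Decidable using (dec-true)
open import Relation.Binary.PropositionalEquality
open import Level using (0ℓ)
open import Algebra.Bundles using (AbelianGroup)
import Algebra.Properties.AbelianGroup as AbelianGroupProperties
import Algebra.Properties.CommutativeMonoid.Mult as MonoidMultiples
import Algebra.Properties.CommutativeMonoid.Sum as MonoidSums
import Algebra.Properties.CommutativeSemigroup as CommutativeSemigroupProperties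

leastWitness : (Q : ℕ → Set) → (∀ k → Dec (Q k)) → ∀ N → Q N →
               ∃ λ d → Q d × (∀ d' → d' < d → ¬ Q d')
leastWitness Q Q? N qN with search N
  where
  search : ∀ N → (∃ λ d → Q d × (∀ d' → d' < d → ¬ Q d')) ⊎ (∀ d → d ≤ N → ¬ Q d)
  search zero with Q? 0
  ... | yes q0 = inj₁ (0 , q0 , λ _ ())
  ... | no ¬q0 = inj₂ (λ { zero _ → ¬q0 })
  search (suc N) with search N
  ... | inj₁ least = inj₁ least
  ... | inj₂ none with Q? (suc N)
  ...   | yes q = inj₁ (suc N , q , λ d' d'<sN → none d' (s≤s⁻¹ d'<sN))
  ...   | no ¬q = inj₂ (λ d d≤sN → case m≤n⇒m<n∨m≡n d≤sN of λ
                    { (inj₁ d<sN) → none d (s≤s⁻¹ d<sN)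
                    ; (inj₂ refl) → ¬q })
... | inj₁ least = least
... | inj₂ none = ⊥-elim (none N ≤-refl qN)

prime∤⇒coprime : ∀ {p m} → Prime p → ¬ p ∣ m → Coprime m p
prime∤⇒coprime pp p∤m (d∣m , d∣p) with prime⇒irreducible pp d∣p
... | inj₁ d≡1 = d≡1
... | inj₂ refl = ⊥-elim (p∤m d∣m)

distinctPrimes⇒coprime : ∀ {p q} → Prime p → Prime q → p ≢ q → Coprime q p
distinctPrimes⇒coprime pp pq p≢q = prime∤⇒coprime pp λ p∣q → case prime⇒irreducible pq p∣q of λ
  { (inj₁ refl) → ¬prime[1] pp ; (inj₂ p≡q) → p≢q p≡q }

primeDivisor : ∀ m → 2 ≤ m → ∃ λ r → Prime r × r ∣ m
primeDivisor m@(suc _) m≥2 with factorise m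
... | record { factors = [] ; isFactorisation = m≡1 } = ⊥-elim (<⇒≢ m≥2 (sym m≡1))
... | record { factors = r ∷ rs ; isFactorisation = m≡ ; factorsPrime = pr ∷ _ } =
      r , pr , subst (r ∣_) (sym m≡) (m∣m*n (product rs))

powerOrOtherPrime : ∀ p (rs : List ℕ) → All Prime rs →
  product rs ≡ p ^ length rs ⊎ ∃ λ q → Prime q × q ≢ p × q ∣ product rs
powerOrOtherPrime p [] _ = inj₁ refl
powerOrOtherPrime p (r ∷ rs) (pr ∷ prs) with r ≟ p
... | no r≢p = inj₂ (r , pr , r≢p , m∣m*n (product rs))
... | yes refl with powerOrOtherPrime p rs prs
...   | inj₁ eq = inj₁ (cong (p *_) eq)
...   | inj₂ (q , pq , q≢p , q∣) = inj₂ (q , pq , q≢p , ∣n⇒∣m*n p q∣)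

primePowerOrTwoPrimes : ∀ n → 2 ≤ n → IsPGroupOrder n ⊎
  ∃ λ p → ∃ λ q → Prime p × Prime q × p ≢ q × (p ∣ n) × (q ∣ n)
primePowerOrTwoPrimes n@(suc _) n≥2 with factorise n
... | record { factors = [] ; isFactorisation = n≡1 } = ⊥-elim (<⇒≢ n≥2 (sym n≡1))
... | record { factors = p ∷ rs ; isFactorisation = n≡ ; factorsPrime = pp ∷ prs }
  with powerOrOtherPrime p (p ∷ rs) (pp ∷ prs)
...   | inj₁ eq = inj₁ (p , suc (length rs) , pp , s≤s z≤n , trans n≡ eq)
...   | inj₂ (q , pq , q≢p , q∣) = inj₂ (p , q , pp , pq , (λ p≡q → q≢p (sym p≡q)) ,
          subst (p ∣_) (sym n≡) (m∣m*n (product rs)) , subst (q ∣_) (sym n≡) q∣)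

firstSwitch : {A : Set} (Q : A → Set) → (∀ x → Dec (Q x)) → (f : ℕ → A) →
              ∀ N → ¬ Q (f 0) → Q (f N) → ∃ λ i → ¬ Q (f i) × Q (f (suc i))
firstSwitch Q Q? f zero ¬q0 qN = ⊥-elim (¬q0 qN)
firstSwitch Q Q? f (suc N) ¬q0 qsN with Q? (f N)
... | yes qN = firstSwitch Q Q? f N ¬q0 qN
... | no ¬qN = N , ¬qN , qsN

anyBelow : ℕ → (ℕ → Bool) → Bool
anyBelow zero f = false
anyBelow (suc j) f = f j ∨ anyBelow j f

anyBelow-intro : ∀ t f j → j < t → f j ≡ true → anyBelow t f ≡ true
anyBelow-intro (suc t) f j j<1+t fj with m<1+n⇒m<n∨m≡n j<1+t
... | inj₂ refl rewrite fj = refl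
... | inj₁ j<t rewrite anyBelow-intro t f j j<t fj = ∨-zeroʳ (f t)

anyBelow-elim : ∀ t f → anyBelow t f ≡ true → ∃ λ j → j < t × f j ≡ true
anyBelow-elim (suc t) f any with f t in ft
... | true = t , ≤-refl , ft
... | false with anyBelow-elim t f any
...   | j , j<t , fj = j , m<n⇒m<1+n j<t , fj

prime>1 : ∀ {p} → Prime p → 1 < p
prime>1 {p} pp = nonTrivial⇒n>1 p {{prime⇒nonTrivial pp}}

doubling-grows : ∀ {t c} → 2 ≤ t → c ≢ 0 → suc c ≤ t * c
doubling-grows {t} {c} t≥2 c≢0 = begin
  1 + c     ≤⟨ +-monoˡ-≤ c (n≢0⇒n>0 c≢0) ⟩
  c + c     ≡⟨ cong (c +_) (sym (+-identityʳ c)) ⟩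
  2 * c     ≤⟨ *-monoˡ-≤ c t≥2 ⟩
  t * c     ∎
  where open ≤-Reasoning

module FiniteAbelianGroup {n : ℕ} (G : FinGroup n) (comm : IsAbelian G) where
  open FinGroup G
  open ≡-Reasoning

  abelianGroup : AbelianGroup 0ℓ 0ℓ
  abelianGroup = record
    { Carrier = Fin n ; _≈_ = _≡_ ; _∙_ = _∙_ ; ε = ε ; _⁻¹ = _⁻¹
    ; isAbelianGroup = record
      { isGroup = record
        { isMonoid = record
          { isSemigroup = record
            { isMagma = record { isEquivalence = isEquivalence ; ∙-cong = cong₂ _∙_ }
            ; assoc = assoc }
          ; identity = identityˡ , identityʳ }
        ; inverse = inverseˡ , inverseʳ
        ; ⁻¹-cong = cong _⁻¹ }
      ; comm = comm } }

  open AbelianGroupProperties abelianGroup public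
    using (∙-cancelʳ; inverseˡ-unique; inverseʳ-unique)
  open CommutativeSemigroupProperties (AbelianGroup.commutativeSemigroup abelianGroup)
    public using (interchange)
  open MonoidMultiples (AbelianGroup.commutativeMonoid abelianGroup)
    using (×-homo-+; ×-assocˡ; ×-distrib-+)
    renaming (_×_ to _·_)
  module Sums = MonoidSums (AbelianGroup.commutativeMonoid abelianGroup)

  infixr 25 _^ᴳ_
  _^ᴳ_ : Fin n → ℕ → Fin n
  x ^ᴳ m = pow G x m

  ^ᴳ≡× : ∀ x m → x ^ᴳ m ≡ m · x
  ^ᴳ≡× x zero = refl
  ^ᴳ≡× x (suc m) = cong (x ∙_) (^ᴳ≡× x m)

  ^ᴳ-+ : ∀ x a b → x ^ᴳ (a + b) ≡ x ^ᴳ a ∙ x ^ᴳ b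
  ^ᴳ-+ x a b rewrite ^ᴳ≡× x (a + b) | ^ᴳ≡× x a | ^ᴳ≡× x b = ×-homo-+ x a b

  ^ᴳ-* : ∀ x a b → x ^ᴳ (a * b) ≡ (x ^ᴳ b) ^ᴳ a
  ^ᴳ-* x a b rewrite ^ᴳ≡× x (a * b) | ^ᴳ≡× x b | ^ᴳ≡× (b · x) a = sym (×-assocˡ x a b)

  ^ᴳ-*ʳ : ∀ x a b → x ^ᴳ (a * b) ≡ (x ^ᴳ a) ^ᴳ b
  ^ᴳ-*ʳ x a b = trans (cong (x ^ᴳ_) (*-comm a b)) (^ᴳ-* x b a)

  ∙-^ᴳ : ∀ x y a → (x ∙ y) ^ᴳ a ≡ x ^ᴳ a ∙ y ^ᴳ a
  ∙-^ᴳ x y a rewrite ^ᴳ≡× (x ∙ y) a | ^ᴳ≡× x a | ^ᴳ≡× y a = ×-distrib-+ x y a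

  ε-^ᴳ : ∀ a → ε ^ᴳ a ≡ ε
  ε-^ᴳ zero = refl
  ε-^ᴳ (suc a) = trans (identityˡ _) (ε-^ᴳ a)

  ^ᴳ-1 : ∀ x → x ^ᴳ 1 ≡ x
  ^ᴳ-1 = identityʳ

  ⁻¹-^ᴳ : ∀ x a → (x ⁻¹) ^ᴳ a ≡ (x ^ᴳ a) ⁻¹
  ⁻¹-^ᴳ x a = inverseˡ-unique _ _ (begin
    (x ⁻¹) ^ᴳ a ∙ x ^ᴳ a ≡⟨ sym (∙-^ᴳ (x ⁻¹) x a) ⟩
    ((x ⁻¹) ∙ x) ^ᴳ a     ≡⟨ cong (_^ᴳ a) (inverseˡ x) ⟩
    ε ^ᴳ a               ≡⟨ ε-^ᴳ a ⟩
    ε                    ∎)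

  ^ᴳ-multiple : ∀ x q {k} → x ^ᴳ k ≡ ε → x ^ᴳ (q * k) ≡ ε
  ^ᴳ-multiple x q {k} x^k≡ε = trans (^ᴳ-* x q k) (trans (cong (_^ᴳ q) x^k≡ε) (ε-^ᴳ q))

  -- Lagrange's theorem for abelian groups: multiplying all elements by x
  -- permutes them, so x ^ n ∙ ∏ G = ∏ G and hence x ^ n = ε.
  ^ᴳ-order-of-G : ∀ x → x ^ᴳ n ≡ ε
  ^ᴳ-order-of-G x = ∙-cancelʳ ΠG (x ^ᴳ n) ε (begin
      x ^ᴳ n ∙ ΠG                  ≡⟨ cong (_∙ ΠG) (sym (constant-product n)) ⟩
      Sums.sum {n} (λ _ → x) ∙ ΠG  ≡⟨ sym (Sums.∑-distrib-+ {n} (λ _ → x) (λ y → y)) ⟩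
      Sums.sum {n} (λ y → x ∙ y)   ≡⟨ sym (Sums.sum-permute {n} {n} (λ y → y) (translation x)) ⟩
      ΠG                           ≡⟨ sym (identityˡ ΠG) ⟩
      ε ∙ ΠG                       ∎)
    where
    ΠG : Fin n
    ΠG = Sums.sum {n} (λ y → y)
    constant-product : ∀ m → Sums.sum {m} (λ _ → x) ≡ x ^ᴳ m
    constant-product zero = refl
    constant-product (suc m) = cong (x ∙_) (constant-product m)
    translation : Fin n → Permutation n n
    translation x = permutation (x ∙_) ((x ⁻¹) ∙_)
      (λ y → trans (sym (assoc _ _ _)) (trans (cong (_∙ y) (inverseʳ x)) (identityˡ y)))
      (λ y → trans (sym (assoc _ _ _)) (trans (cong (_∙ y) (inverseˡ x)) (identityˡ y)))

  instance
    n-nonZero : NonZero n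
    n-nonZero = ≢-nonZero (λ n≡0 → ¬Fin0 (subst Fin n≡0 ε))

  ^ᴳ-divMod : ∀ x t d .{{_ : NonZero d}} → x ^ᴳ t ≡ x ^ᴳ (t % d) ∙ (x ^ᴳ d) ^ᴳ (t / d)
  ^ᴳ-divMod x t d = begin
    x ^ᴳ t                              ≡⟨ cong (x ^ᴳ_) (m≡m%n+[m/n]*n t d) ⟩
    x ^ᴳ (t % d + t / d * d)            ≡⟨ ^ᴳ-+ x (t % d) (t / d * d) ⟩
    x ^ᴳ (t % d) ∙ x ^ᴳ (t / d * d)     ≡⟨ cong (x ^ᴳ (t % d) ∙_) (^ᴳ-* x (t / d) d) ⟩
    x ^ᴳ (t % d) ∙ (x ^ᴳ d) ^ᴳ (t / d)  ∎

  ^ᴳ-mod : ∀ x t d .{{_ : NonZero d}} → x ^ᴳ d ≡ ε → x ^ᴳ t ≡ x ^ᴳ (t % d)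
  ^ᴳ-mod x t d x^d≡ε = begin
    x ^ᴳ t                             ≡⟨ ^ᴳ-divMod x t d ⟩
    x ^ᴳ (t % d) ∙ (x ^ᴳ d) ^ᴳ (t / d) ≡⟨ cong (λ y → x ^ᴳ (t % d) ∙ y ^ᴳ (t / d)) x^d≡ε ⟩
    x ^ᴳ (t % d) ∙ ε ^ᴳ (t / d)        ≡⟨ cong (x ^ᴳ (t % d) ∙_) (ε-^ᴳ (t / d)) ⟩
    x ^ᴳ (t % d) ∙ ε                   ≡⟨ identityʳ _ ⟩
    x ^ᴳ (t % d)                       ∎

  private
    leastKillingExponent : ∀ x → ∃ λ d → x ^ᴳ suc d ≡ ε × (∀ d' → d' < d → x ^ᴳ suc d' ≢ ε)
    leastKillingExponent x = leastWitness (λ d → x ^ᴳ suc d ≡ ε) (λ d → x ^ᴳ suc d ≟ᶠ ε) (pred n)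
      (trans (cong (x ^ᴳ_) (suc-pred n)) (^ᴳ-order-of-G x))

  order : Fin n → ℕ
  order x = suc (proj₁ (leastKillingExponent x))

  ^ᴳ-order : ∀ x → x ^ᴳ order x ≡ ε
  ^ᴳ-order x = proj₁ (proj₂ (leastKillingExponent x))

  order-minimal : ∀ x j → 0 < j → j < order x → x ^ᴳ j ≢ ε
  order-minimal x (suc j) _ j<o = proj₂ (proj₂ (leastKillingExponent x)) j (s≤s⁻¹ j<o)

  order-∣ : ∀ x t → x ^ᴳ t ≡ ε → order x ∣ t
  order-∣ x t x^t≡ε = m%n≡0⇒n∣m t (order x) (remainder≡0 (t % order x) refl)
    where
    remainder≡0 : ∀ r → r ≡ t % order x → r ≡ 0
    remainder≡0 zero _ = refl
    remainder≡0 (suc r) r≡ = ⊥-elim (order-minimal x (suc r) (s≤s z≤n)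
      (subst (_< order x) (sym r≡) (m%n<n t (order x)))
      (trans (cong (x ^ᴳ_) r≡) (trans (sym (^ᴳ-mod x t (order x) (^ᴳ-order x))) x^t≡ε)))

  ∣-order : ∀ x t → order x ∣ t → x ^ᴳ t ≡ ε
  ∣-order x t (divides q refl) = ^ᴳ-multiple x q (^ᴳ-order x)

  order≥2 : ∀ x → x ≢ ε → 2 ≤ order x
  order≥2 x x≢ε with proj₁ (leastKillingExponent x) | proj₁ (proj₂ (leastKillingExponent x))
  ... | zero  | x^1≡ε = ⊥-elim (x≢ε (trans (sym (^ᴳ-1 x)) x^1≡ε))
  ... | suc _ | _     = s≤s (s≤s z≤n)

  elementOfOrderDividing : ∀ x d → 1 < d → d ∣ order x → ∃ λ k → x ^ᴳ k ≢ ε × (x ^ᴳ k) ^ᴳ d ≡ ε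
  elementOfOrderDividing x d d>1 (divides zero o≡0) = ⊥-elim (1+n≢0 o≡0)
  elementOfOrderDividing x d d>1 (divides k@(suc _) o≡kd) = k , nontrivial , killed
    where
    nontrivial : x ^ᴳ k ≢ ε
    nontrivial = order-minimal x k (s≤s z≤n) (subst (k <_) (sym o≡kd) (m<m*n k d d>1))
    killed : (x ^ᴳ k) ^ᴳ d ≡ ε
    killed = trans (sym (^ᴳ-*ʳ x k d)) (trans (cong (x ^ᴳ_) (sym o≡kd)) (^ᴳ-order x))

  infix 4 _∈⟨_⟩
  _∈⟨_⟩ : Fin n → Fin n → Set
  y ∈⟨ x ⟩ = ∃ λ m → x ^ᴳ m ≡ y

  ∈⟨⟩-refl : ∀ x → x ∈⟨ x ⟩
  ∈⟨⟩-refl x = 1 , ^ᴳ-1 x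

  ∈⟨⟩-trans : ∀ {x y z} → z ∈⟨ y ⟩ → y ∈⟨ x ⟩ → z ∈⟨ x ⟩
  ∈⟨⟩-trans {x} (k , refl) (m , refl) = k * m , ^ᴳ-* x k m

  ^ᴳ-∈⟨⟩ : ∀ x k → x ^ᴳ k ∈⟨ x ⟩
  ^ᴳ-∈⟨⟩ x k = k , refl

  ∈⟨⟩-∙ : ∀ {g x y} → x ∈⟨ g ⟩ → y ∈⟨ g ⟩ → x ∙ y ∈⟨ g ⟩
  ∈⟨⟩-∙ {g} (m , refl) (l , refl) = m + l , ^ᴳ-+ g m l

  -- Exponents below n suffice (Lagrange), so membership is decidable.
  _∈⟨_⟩? : ∀ y x → Dec (y ∈⟨ x ⟩)
  y ∈⟨ x ⟩? with any? (λ (i : Fin n) → x ^ᴳ toℕ i ≟ᶠ y)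
  ... | yes (i , x^i≡y) = yes (toℕ i , x^i≡y)
  ... | no none = no λ { (m , x^m≡y) → none (fromℕ< (m%n<n m n) ,
          trans (cong (x ^ᴳ_) (toℕ-fromℕ< (m%n<n m n)))
                (trans (sym (^ᴳ-mod x m n (^ᴳ-order-of-G x))) x^m≡y)) }

  -- x⁻¹ = x ^ (n - 1) by Lagrange.
  ⁻¹-∈⟨⟩ : ∀ x → x ⁻¹ ∈⟨ x ⟩
  ⁻¹-∈⟨⟩ x = pred n , inverseʳ-unique x _
    (trans (cong (x ^ᴳ_) (suc-pred n)) (^ᴳ-order-of-G x))

  -- If c ^ k = ε and t is coprime to k then c is a power of c ^ t
  -- (take the Bézout inverse of t modulo k).
  coprimePower-generates : ∀ {k} c t → c ^ᴳ k ≡ ε → Coprime t k → c ∈⟨ c ^ᴳ t ⟩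
  coprimePower-generates {k} c t c^k≡ε t⊥k with coprime-Bézout t⊥k
  ... | Bézout.+- x y 1+yk≡xt = x , (begin
    (c ^ᴳ t) ^ᴳ x       ≡⟨ sym (^ᴳ-* c x t) ⟩
    c ^ᴳ (x * t)        ≡⟨ cong (c ^ᴳ_) (sym 1+yk≡xt) ⟩
    c ∙ c ^ᴳ (y * k)    ≡⟨ cong (c ∙_) (^ᴳ-multiple c y c^k≡ε) ⟩
    c ∙ ε               ≡⟨ identityʳ c ⟩
    c                   ∎)
  ... | Bézout.-+ x y 1+xt≡yk =
    subst (_∈⟨ c ^ᴳ t ⟩) (sym c≡w⁻¹) (∈⟨⟩-trans (⁻¹-∈⟨⟩ w) (^ᴳ-∈⟨⟩ (c ^ᴳ t) x))
    where
    w : Fin n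
    w = (c ^ᴳ t) ^ᴳ x
    c≡w⁻¹ : c ≡ w ⁻¹
    c≡w⁻¹ = inverseˡ-unique c w (begin
      c ∙ (c ^ᴳ t) ^ᴳ x ≡⟨ cong (c ∙_) (sym (^ᴳ-* c x t)) ⟩
      c ^ᴳ (1 + x * t)  ≡⟨ cong (c ^ᴳ_) 1+xt≡yk ⟩
      c ^ᴳ (y * k)      ≡⟨ ^ᴳ-multiple c y c^k≡ε ⟩
      ε                 ∎)

  -- If z ^ r = ε, w ^ s = ε and s is coprime to r, then z is a power of z ∙ w
  -- (namely of (z ∙ w) ^ s = z ^ s).
  factor-∈⟨product⟩ : ∀ {r s} z w → z ^ᴳ r ≡ ε → w ^ᴳ s ≡ ε → Coprime s r → z ∈⟨ z ∙ w ⟩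
  factor-∈⟨product⟩ {r} {s} z w z^r≡ε w^s≡ε s⊥r =
    ∈⟨⟩-trans (coprimePower-generates z s z^r≡ε s⊥r) (s , (begin
      (z ∙ w) ^ᴳ s      ≡⟨ ∙-^ᴳ z w s ⟩
      z ^ᴳ s ∙ w ^ᴳ s   ≡⟨ cong (z ^ᴳ s ∙_) w^s≡ε ⟩
      z ^ᴳ s ∙ ε        ≡⟨ identityʳ _ ⟩
      z ^ᴳ s            ∎))

  primeOrder-∣ : ∀ {p} a t → Prime p → a ^ᴳ p ≡ ε → a ≢ ε → a ^ᴳ t ≡ ε → p ∣ t
  primeOrder-∣ {p} a t pp a^p≡ε a≢ε a^t≡ε with p ∣? t
  ... | yes p∣t = p∣t
  ... | no p∤t with coprimePower-generates a t a^p≡ε (prime∤⇒coprime pp p∤t)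
  ...   | m , a^tm≡a = ⊥-elim (a≢ε (trans (sym a^tm≡a) (trans (cong (_^ᴳ m) a^t≡ε) (ε-^ᴳ m))))

  correctOutside : ∀ {g h y} k → ¬ h ∈⟨ g ⟩ → y ∈⟨ g ⟩ → h ^ᴳ k ≡ y ^ᴳ k →
                   ¬ h ∙ (y ⁻¹) ∈⟨ g ⟩ × (h ∙ (y ⁻¹)) ^ᴳ k ≡ ε
  correctOutside {g} {h} {y} k h∉⟨g⟩ y∈⟨g⟩ h^k≡y^k = outside , killed
    where
    outside : ¬ h ∙ (y ⁻¹) ∈⟨ g ⟩
    outside b∈⟨g⟩ = h∉⟨g⟩ (subst (_∈⟨ g ⟩) by≡h (∈⟨⟩-∙ b∈⟨g⟩ y∈⟨g⟩))
      where
      by≡h : (h ∙ (y ⁻¹)) ∙ y ≡ h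
      by≡h = trans (assoc _ _ _) (trans (cong (h ∙_) (inverseˡ y)) (identityʳ h))
    killed : (h ∙ (y ⁻¹)) ^ᴳ k ≡ ε
    killed = begin
      (h ∙ (y ⁻¹)) ^ᴳ k        ≡⟨ ∙-^ᴳ h (y ⁻¹) k ⟩
      h ^ᴳ k ∙ (y ⁻¹) ^ᴳ k     ≡⟨ cong₂ _∙_ h^k≡y^k (⁻¹-^ᴳ y k) ⟩
      y ^ᴳ k ∙ ((y ^ᴳ k) ⁻¹)   ≡⟨ inverseʳ _ ⟩
      ε                        ∎

  -- A cyclic group ⟨ u ⟩ has at most one subgroup of prime order p: if a, z ∈ ⟨ u ⟩
  -- are killed by p and z ≠ ε, then a ∈ ⟨ z ⟩.
  uniquePrimeOrderSubgroup : ∀ {p} u a z → Prime p → a ∈⟨ u ⟩ → z ∈⟨ u ⟩ →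
                             a ^ᴳ p ≡ ε → z ^ᴳ p ≡ ε → z ≢ ε → a ∈⟨ z ⟩
  uniquePrimeOrderSubgroup {p} u a z pp (α , refl) (β , refl) a^p≡ε z^p≡ε z≢ε
    with p ∣? order u
  ... | no p∤o = ⊥-elim (z≢ε (∣-order u β (coprime-divisor (prime∤⇒coprime pp p∤o)
          (order-∣ u (p * β) (trans (^ᴳ-* u p β) z^p≡ε)))))
  ... | yes (divides M o≡Mp) = ∈⟨⟩-trans (∈⟨c⟩ α a^p≡ε) c∈⟨z⟩
    where
    instance
      p-nonZero : NonZero p
      p-nonZero = prime⇒nonZero pp
    c : Fin n
    c = u ^ᴳ M
    c^p≡ε : c ^ᴳ p ≡ ε
    c^p≡ε = trans (sym (^ᴳ-*ʳ u M p)) (trans (cong (u ^ᴳ_) (sym o≡Mp)) (^ᴳ-order u))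
    ∈⟨c⟩ : ∀ k → (u ^ᴳ k) ^ᴳ p ≡ ε → u ^ᴳ k ∈⟨ c ⟩
    ∈⟨c⟩ k killed with *-cancelʳ-∣ {M} {k} p (subst (_∣ k * p) o≡Mp
                         (order-∣ u (k * p) (trans (^ᴳ-*ʳ u k p) killed)))
    ... | divides q refl = q , sym (^ᴳ-* u q M)
    -- z = c ^ β' with p ∤ β' since z ≠ ε, so c is a power of z
    c∈⟨z⟩ : c ∈⟨ u ^ᴳ β ⟩
    c∈⟨z⟩ with ∈⟨c⟩ β z^p≡ε
    ... | β' , c^β'≡z =
      subst (c ∈⟨_⟩) c^β'≡z (coprimePower-generates c β' c^p≡ε (prime∤⇒coprime pp p∤β'))
      where
      p∤β' : ¬ p ∣ β'
      p∤β' (divides q refl) = z≢ε (trans (sym c^β'≡z) (^ᴳ-multiple c q c^p≡ε))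

module Counting where
  private
    module ℕSums = MonoidSums +-0-commutativeMonoid
    open CommutativeSemigroupProperties +-commutativeSemigroup using () renaming (interchange to +-interchange)

  indicator : Bool → ℕ
  indicator true = 1
  indicator false = 0

  count : ∀ {N} → (Fin N → Bool) → ℕ
  count {N} K = ℕSums.sum {N} (λ x → indicator (K x))

  indicator≤1 : ∀ b → indicator b ≤ 1
  indicator≤1 true = s≤s z≤n
  indicator≤1 false = z≤n

  count≤ : ∀ {N} (K : Fin N → Bool) → count K ≤ N
  count≤ {zero} K = z≤n
  count≤ {suc N} K = +-mono-≤ (indicator≤1 (K fzero)) (count≤ (λ x → K (fsuc x)))

  count< : ∀ {N} (K : Fin N → Bool) g → K g ≡ false → count K < N
  count< {suc N} K fzero Kg≡false rewrite Kg≡false = s≤s (count≤ (λ x → K (fsuc x)))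
  count< {suc N} K (fsuc g) Kg≡false =
    +-mono-≤-< (indicator≤1 (K fzero)) (count< (λ x → K (fsuc x)) g Kg≡false)

  count-all : ∀ {N} (K : Fin N → Bool) → (∀ x → K x ≡ true) → count K ≡ N
  count-all {zero} K all = refl
  count-all {suc N} K all rewrite all fzero = cong suc (count-all (λ x → K (fsuc x)) (λ x → all (fsuc x)))

  count-none : ∀ {N} (K : Fin N → Bool) → (∀ x → K x ≡ false) → count K ≡ 0
  count-none {zero} K none = refl
  count-none {suc N} K none rewrite none fzero = count-none (λ x → K (fsuc x)) (λ x → none (fsuc x))

  count-singleton : ∀ {N} (a : Fin N) → count (λ x → does (x ≟ᶠ a)) ≡ 1
  count-singleton {suc N} fzero = cong suc (count-none {N} (λ x → does (fsuc x ≟ᶠ fzero)) (λ x → refl))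
  count-singleton {suc N} (fsuc a) = count-singleton a

  count-∨ : ∀ {N} (K L : Fin N → Bool) → (∀ x → K x ∧ L x ≡ false) →
            count (λ x → K x ∨ L x) ≡ count K + count L
  count-∨ {zero} K L disjoint = refl
  count-∨ {suc N} K L disjoint = begin
      indicator (K fzero ∨ L fzero) + count (λ x → K (fsuc x) ∨ L (fsuc x))
        ≡⟨ cong₂ _+_ (indicator-∨ (K fzero) (L fzero) (disjoint fzero))
                     (count-∨ (λ x → K (fsuc x)) (λ x → L (fsuc x)) (λ x → disjoint (fsuc x))) ⟩
      (indicator (K fzero) + indicator (L fzero)) + (count (λ x → K (fsuc x)) + count (λ x → L (fsuc x)))
        ≡⟨ +-interchange (indicator (K fzero)) _ _ _ ⟩
      (indicator (K fzero) + count (λ x → K (fsuc x))) + (indicator (L fzero) + count (λ x → L (fsuc x))) ∎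
    where
    open ≡-Reasoning
    indicator-∨ : ∀ a b → a ∧ b ≡ false → indicator (a ∨ b) ≡ indicator a + indicator b
    indicator-∨ true  true  ()
    indicator-∨ true  false _ = refl
    indicator-∨ false b     _ = refl

  count-bijection : ∀ {N} (K : Fin N → Bool) (f g : Fin N → Fin N) →
                    (∀ x → f (g x) ≡ x) → (∀ x → g (f x) ≡ x) → count (λ x → K (f x)) ≡ count K
  count-bijection {N} K f g fg gf = sym (ℕSums.sum-permute {N} {N} (λ x → indicator (K x)) (permutation f g fg gf))

-- Cauchy's theorem for finite abelian groups, by growing a subgroup whose
-- order is prime to q until it exhausts G.
module AbelianCauchy {n : ℕ} (G : FinGroup n) (comm : IsAbelian G) where
  open FinGroup G
  open FiniteAbelianGroup G comm
  open Counting
  open ≡-Reasoning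

  -- A subgroup, given by a Boolean membership predicate containing ε and closed
  -- under products (closure under inverses follows by finiteness).
  record Subgroup : Set where
    field
      member   : Fin n → Bool
      ε-member : member ε ≡ true
      ∙-member : ∀ x y → member x ≡ true → member y ≡ true → member (x ∙ y) ≡ true

  module SubgroupProperties (K : Subgroup) where
    open Subgroup K

    _∈K : Fin n → Set
    x ∈K = member x ≡ true

    ^ᴳ-member : ∀ x m → x ∈K → (x ^ᴳ m) ∈K
    ^ᴳ-member x zero _ = ε-member
    ^ᴳ-member x (suc m) x∈K = ∙-member x _ x∈K (^ᴳ-member x m x∈K)

    cancel-memberʳ : ∀ y z → (y ∙ z) ∈K → z ∈K → y ∈K
    cancel-memberʳ y z yz∈K z∈K = subst _∈K yz∙z⁻¹≡y (∙-member _ _ yz∈K z⁻¹∈K)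
      where
      z⁻¹∈K : (z ⁻¹) ∈K
      z⁻¹∈K with ⁻¹-∈⟨⟩ z
      ... | m , z^m≡z⁻¹ = subst _∈K z^m≡z⁻¹ (^ᴳ-member z m z∈K)
      yz∙z⁻¹≡y : (y ∙ z) ∙ (z ⁻¹) ≡ y
      yz∙z⁻¹≡y = trans (assoc _ _ _) (trans (cong (y ∙_) (inverseʳ z)) (identityʳ y))

    cancel-memberˡ : ∀ y z → (y ∙ z) ∈K → y ∈K → z ∈K
    cancel-memberˡ y z yz∈K y∈K = cancel-memberʳ z y (subst _∈K (comm y z) yz∈K) y∈K

  -- Let t be the least positive exponent with g ^ t ∈ K.  Then
  -- K⟨g⟩ is the union of the t disjoint cosets {x | x ∙ g ^ j ∈ K}, j < t, so it
  -- has t · |K| elements; moreover t divides the order of g.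
  module Adjoin (K : Subgroup) (g : Fin n) (g∉K : Subgroup.member K g ≡ false) where
    open Subgroup K
    open SubgroupProperties K

    private
      leastExponentInK : ∃ λ d → (g ^ᴳ suc d) ∈K × (∀ d' → d' < d → ¬ (g ^ᴳ suc d') ∈K)
      leastExponentInK = leastWitness (λ d → (g ^ᴳ suc d) ∈K) (λ d → member (g ^ᴳ suc d) ≟ᵇ true)
        (pred n) (subst _∈K (sym (trans (cong (g ^ᴳ_) (suc-pred n)) (^ᴳ-order-of-G g))) ε-member)

    index : ℕ
    index = suc (proj₁ leastExponentInK)

    g^index∈K : (g ^ᴳ index) ∈K
    g^index∈K = proj₁ (proj₂ leastExponentInK)

    index-minimal : ∀ j → 0 < j → j < index → ¬ (g ^ᴳ j) ∈K
    index-minimal (suc j) _ j<t = proj₂ (proj₂ leastExponentInK) j (s≤s⁻¹ j<t)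

    index-∣ : ∀ j → (g ^ᴳ j) ∈K → index ∣ j
    index-∣ j g^j∈K = m%n≡0⇒n∣m j index (remainder≡0 (j % index) refl)
      where
      g^r∈K : (g ^ᴳ (j % index)) ∈K
      g^r∈K = cancel-memberʳ _ _ (subst _∈K (^ᴳ-divMod g j index) g^j∈K)
                (^ᴳ-member _ (j / index) g^index∈K)
      remainder≡0 : ∀ r → r ≡ j % index → r ≡ 0
      remainder≡0 zero _ = refl
      remainder≡0 (suc r) r≡ = ⊥-elim (index-minimal (suc r) (s≤s z≤n)
        (subst (_< index) (sym r≡) (m%n<n j index)) (subst (λ e → (g ^ᴳ e) ∈K) (sym r≡) g^r∈K))

    index≥2 : 2 ≤ index
    index≥2 with proj₁ leastExponentInK | proj₁ (proj₂ leastExponentInK)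
    ... | zero  | g^1∈K = ⊥-elim (true≢false (trans (sym (subst _∈K (^ᴳ-1 g) g^1∈K)) g∉K))
      where true≢false : true ≢ false
            true≢false ()
    ... | suc _ | _     = s≤s (s≤s z≤n)

    index∣order : index ∣ order g
    index∣order = index-∣ (order g) (subst _∈K (sym (^ᴳ-order g)) ε-member)

    inCoset : Fin n → ℕ → Bool
    inCoset x j = member (x ∙ g ^ᴳ j)

    adjoined : Fin n → Bool
    adjoined x = anyBelow index (inCoset x)

    inCoset-shift : ∀ x j → inCoset x (index + j) ≡ true → inCoset x j ≡ true
    inCoset-shift x j in-t+j = cancel-memberʳ _ _ (subst _∈K shift in-t+j) g^index∈K
      where
      shift : x ∙ g ^ᴳ (index + j) ≡ (x ∙ g ^ᴳ j) ∙ g ^ᴳ index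
      shift = begin
        x ∙ g ^ᴳ (index + j)          ≡⟨ cong (x ∙_) (^ᴳ-+ g index j) ⟩
        x ∙ (g ^ᴳ index ∙ g ^ᴳ j)     ≡⟨ cong (x ∙_) (comm _ _) ⟩
        x ∙ (g ^ᴳ j ∙ g ^ᴳ index)     ≡⟨ sym (assoc _ _ _) ⟩
        (x ∙ g ^ᴳ j) ∙ g ^ᴳ index     ∎

    cosets-disjoint : ∀ x s j → j < s → s < index → inCoset x s ≡ true → inCoset x j ≡ true → ⊥
    cosets-disjoint x s j j<s s<t in-s in-j =
      index-minimal (s ∸ j) (m<n⇒0<n∸m j<s) (≤-<-trans (m∸n≤m s j) s<t)
        (cancel-memberˡ _ _ (subst _∈K split in-s) in-j)
      where
      split : x ∙ g ^ᴳ s ≡ (x ∙ g ^ᴳ j) ∙ g ^ᴳ (s ∸ j)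
      split = trans (cong (λ e → x ∙ g ^ᴳ e) (sym (m+[n∸m]≡n (<⇒≤ j<s))))
                (trans (cong (x ∙_) (^ᴳ-+ g j (s ∸ j))) (sym (assoc _ _ _)))

    -- each coset is the translate of K by g ^ s, hence as large as K
    count-coset : ∀ s → count (λ x → inCoset x s) ≡ count member
    count-coset s = count-bijection member (_∙ c) (_∙ (c ⁻¹))
        (λ x → trans (assoc _ _ _) (trans (cong (x ∙_) (inverseˡ c)) (identityʳ x)))
        (λ x → trans (assoc _ _ _) (trans (cong (x ∙_) (inverseʳ c)) (identityʳ x)))
      where c = g ^ᴳ s

    count-adjoined : count adjoined ≡ index * count member
    count-adjoined = count-first-cosets index ≤-refl
      where
      count-first-cosets : ∀ s → s ≤ index → count (λ x → anyBelow s (inCoset x)) ≡ s * count member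
      count-first-cosets zero _ = count-none {n} (λ x → false) (λ x → refl)
      count-first-cosets (suc s) s<t =
        trans (count-∨ (λ x → inCoset x s) (λ x → anyBelow s (inCoset x)) disjoint)
              (cong₂ _+_ (count-coset s) (count-first-cosets s (<⇒≤ s<t)))
        where
        disjoint : ∀ x → inCoset x s ∧ anyBelow s (inCoset x) ≡ false
        disjoint x with inCoset x s in in-s | anyBelow s (inCoset x) in in-below
        ... | false | _     = refl
        ... | true  | false = refl
        ... | true  | true with anyBelow-elim s (inCoset x) in-below
        ...   | j , j<s , in-j = ⊥-elim (cosets-disjoint x s j j<s s<t in-s in-j)

    -- K⟨g⟩ is closed under products: exponents add, and reduce modulo t
    adjoined-∙ : ∀ x y → adjoined x ≡ true → adjoined y ≡ true → adjoined (x ∙ y) ≡ true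
    adjoined-∙ x y x∈ y∈ with anyBelow-elim index (inCoset x) x∈ | anyBelow-elim index (inCoset y) y∈
    ... | i , i<t , in-i | j , j<t , in-j = reduce (i + j) (+-mono-< i<t j<t) in-i+j
      where
      in-i+j : inCoset (x ∙ y) (i + j) ≡ true
      in-i+j = subst _∈K (trans (interchange x (g ^ᴳ i) y (g ^ᴳ j))
                                (cong ((x ∙ y) ∙_) (sym (^ᴳ-+ g i j))))
                     (∙-member _ _ in-i in-j)
      reduce : ∀ k → k < index + index → inCoset (x ∙ y) k ≡ true → adjoined (x ∙ y) ≡ true
      reduce k k<2t in-k with k <? index
      ... | yes k<t = anyBelow-intro index _ k k<t in-k
      ... | no k≮t = anyBelow-intro index _ (k ∸ index) (m<n+o⇒m∸n<o k index k<2t)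
          (inCoset-shift (x ∙ y) (k ∸ index)
            (subst (λ e → inCoset (x ∙ y) e ≡ true) (sym (m+[n∸m]≡n (≮⇒≥ k≮t))) in-k))

    extension : Subgroup
    extension = record
      { member = adjoined
      ; ε-member = anyBelow-intro index (inCoset ε) 0 (s≤s z≤n) (subst _∈K (sym (identityˡ ε)) ε-member)
      ; ∙-member = adjoined-∙ }

  trivialSubgroup : Subgroup
  trivialSubgroup = record
    { member = λ x → does (x ≟ᶠ ε) ; ε-member = dec-true (ε ≟ᶠ ε) refl ; ∙-member = closed }
    where
    closed : ∀ x y → does (x ≟ᶠ ε) ≡ true → does (y ≟ᶠ ε) ≡ true → does ((x ∙ y) ≟ᶠ ε) ≡ true
    closed x y x∈ y∈ with x ≟ᶠ ε | y ≟ᶠ ε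
    closed x y x∈ y∈ | yes refl | yes refl = dec-true ((ε ∙ ε) ≟ᶠ ε) (identityˡ ε)
    closed x y ()  y∈ | no _     | _
    closed x y x∈  () | yes _    | no _

  module _ (q : ℕ) (pq : Prime q) (q∣n : q ∣ n) where
    open Subgroup

    -- Grow a subgroup K of order prime to q by adjoining some g ∉ K (K ≠ G, as
    -- q ∣ n).  Either q ∣ order g and a power of g has order q, or |K⟨g⟩| = t · |K|
    -- with t ∣ order g stays prime to q.  The fuel f bounds the growth still possible.
    growSubgroup : ∀ f (K : Subgroup) → n ≤ count (member K) + f → ¬ q ∣ count (member K) →
                   ∃ λ x → x ≢ ε × x ^ᴳ q ≡ ε
    growSubgroup f K bound q∤|K| with any? (λ x → member K x ≟ᵇ false)
    ... | no K-full = ⊥-elim (q∤|K| (subst (q ∣_)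
            (sym (count-all (member K) (λ x → ¬-not (λ x∉K → K-full (x , x∉K))))) q∣n))
    ... | yes (g , g∉K) with q ∣? order g
    ...   | yes q∣o with elementOfOrderDividing g q (prime>1 pq) q∣o
    ...     | k , g^k≢ε , g^kq≡ε = g ^ᴳ k , g^k≢ε , g^kq≡ε
    growSubgroup f K bound q∤|K| | yes (g , g∉K) | no q∤o with f
    ... | zero = ⊥-elim (<⇒≱ (count< (member K) g g∉K) (subst (n ≤_) (+-identityʳ _) bound))
    ... | suc f' = growSubgroup f' extension bound' q∤|K⟨g⟩|
      where
      open Adjoin K g g∉K
      |K| : ℕ
      |K| = count (member K)
      |K|≢0 : |K| ≢ 0
      |K|≢0 |K|≡0 = q∤|K| (subst (q ∣_) (sym |K|≡0) (q ∣0))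
      bound' : n ≤ count adjoined + f'
      bound' = ≤-trans bound (subst (_≤ count adjoined + f') (sym (+-suc |K| f'))
                 (+-monoˡ-≤ f' (subst (suc |K| ≤_) (sym count-adjoined)
                   (doubling-grows index≥2 |K|≢0))))
      q∤|K⟨g⟩| : ¬ q ∣ count adjoined
      q∤|K⟨g⟩| q∣ with euclidsLemma index |K| pq (subst (q ∣_) count-adjoined q∣)
      ... | inj₁ q∣t = q∤o (∣-trans q∣t index∣order)
      ... | inj₂ q∣K = q∤|K| q∣K

    cauchy : ∃ λ x → x ≢ ε × x ^ᴳ q ≡ ε
    cauchy = growSubgroup n trivialSubgroup (subst (λ c → n ≤ c + n) (sym (count-singleton ε)) (n≤1+n n))
      (λ q∣1 → ¬prime[1] (subst Prime (∣1⇒≡1 (subst (q ∣_) (count-singleton ε) q∣1)) pq))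

member⇒size≥1 : ∀ {N} {S : Subset N} {x} → x ∈ S → 1 ≤ ∣ S ∣
member⇒size≥1 x∈S = ≤-trans (s≤s z≤n) (x∈p⇒∣p-x∣<∣p∣ x∈S)

members⇒size≥2 : ∀ {N} {S : Subset N} {x y} → x ∈ S → y ∈ S → x ≢ y → 2 ≤ ∣ S ∣
members⇒size≥2 x∈S y∈S x≢y = ≤-trans (s≤s (member⇒size≥1 (x∈p∧x≢y⇒x∈p-y x∈S x≢y))) (x∈p⇒∣p-x∣<∣p∣ y∈S)

module Paths {N : ℕ} {Adj : Fin N → Fin N → Set} {S : Subset N} where

  path-++ : ∀ {u w v} → PathAvoiding Adj S u w → PathAvoiding Adj S w v → PathAvoiding Adj S u v
  path-++ (here _) q = q
  path-++ (step u∉S adj p) q = step u∉S adj (path-++ p q)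

  path-start∉ : ∀ {u v} → PathAvoiding Adj S u v → u ∉ S
  path-start∉ (here u∉S) = u∉S
  path-start∉ (step u∉S _ _) = u∉S

  path-reverse : (∀ {u v} → Adj u v → Adj v u) → ∀ {u v} → PathAvoiding Adj S u v → PathAvoiding Adj S v u
  path-reverse adj-sym (here u∉S) = here u∉S
  path-reverse adj-sym (step u∉S adj rest) =
    path-++ (path-reverse adj-sym rest) (step (path-start∉ rest) (adj-sym adj) (here u∉S))

  ConnectedAfterRemoving : Set
  ConnectedAfterRemoving = ∀ u v → u ∉ S → v ∉ S → PathAvoiding Adj S u v

  connected⇒¬disconnected : ConnectedAfterRemoving → ¬ DisconnectedAfterRemoving Adj S
  connected⇒¬disconnected conn (u , v , u∉S , v∉S , no-path) = no-path (conn u v u∉S v∉S)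

  dominating⇒connected : ∀ c → c ∉ S → (∀ v → c ≢ v → Adj c v × Adj v c) → ConnectedAfterRemoving
  dominating⇒connected c c∉S adj-c u v u∉S v∉S = path-++ (to-c u u∉S) (from-c v v∉S)
    where
    to-c : ∀ u → u ∉ S → PathAvoiding Adj S u c
    to-c u u∉S with c ≟ᶠ u
    ... | yes refl = here c∉S
    ... | no c≢u = step u∉S (proj₂ (adj-c u c≢u)) (here c∉S)
    from-c : ∀ v → v ∉ S → PathAvoiding Adj S c v
    from-c v v∉S with c ≟ᶠ v
    ... | yes refl = here c∉S
    ... | no c≢v = step c∉S (proj₁ (adj-c v c≢v)) (here v∉S)

module PowerGraph {n : ℕ} (G : FinGroup n) (comm : IsAbelian G) where
  open FinGroup G
  open FiniteAbelianGroup G comm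
  open AbelianCauchy G comm using (cauchy)
  open Paths
  open ≡-Reasoning

  Path : Subset n → Fin n → Fin n → Set
  Path S = PathAvoiding (PowerAdj G) S

  powerAdj-sym : ∀ {u v} → PowerAdj G u v → PowerAdj G v u
  powerAdj-sym (u≢v , adj) = (λ v≡u → u≢v (sym v≡u)) , swap adj

  -- ε = x ^ 0 is adjacent to every x, so removing a set without ε leaves P(G) connected.
  ε∉S⇒connected : ∀ S → ε ∉ S → ConnectedAfterRemoving {Adj = PowerAdj G} {S = S}
  ε∉S⇒connected S ε∉S = dominating⇒connected ε ε∉S
    (λ v ε≢v → (ε≢v , inj₂ (0 , refl)) , powerAdj-sym (ε≢v , inj₂ (0 , refl)))

  module RemovingOnlyε (S : Subset n) (nontrivial∉S : ∀ x → x ≢ ε → x ∉ S) where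

    power-path : ∀ {x y} → y ∈⟨ x ⟩ → x ≢ ε → y ≢ ε → Path S x y
    power-path {x} {y} y∈⟨x⟩ x≢ε y≢ε with x ≟ᶠ y
    ... | yes refl = here (nontrivial∉S x x≢ε)
    ... | no x≢y = step (nontrivial∉S x x≢ε) (x≢y , inj₁ y∈⟨x⟩) (here (nontrivial∉S y y≢ε))

    -- nontrivial z, w of distinct prime orders are joined through z ∙ w, of which both are powers
    distinctPrimeOrders-path : ∀ {r s} z w → Prime r → Prime s → r ≢ s → z ^ᴳ r ≡ ε → w ^ᴳ s ≡ ε →
                               z ≢ ε → w ≢ ε → Path S z w
    distinctPrimeOrders-path {r} {s} z w pr ps r≢s z^r≡ε w^s≡ε z≢ε w≢ε =
      path-++ (path-reverse powerAdj-sym (power-path z∈⟨zw⟩ zw≢ε z≢ε)) (power-path w∈⟨zw⟩ zw≢ε w≢ε)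
      where
      z∈⟨zw⟩ : z ∈⟨ z ∙ w ⟩
      z∈⟨zw⟩ = factor-∈⟨product⟩ z w z^r≡ε w^s≡ε (distinctPrimes⇒coprime pr ps r≢s)
      w∈⟨zw⟩ : w ∈⟨ z ∙ w ⟩
      w∈⟨zw⟩ = subst (w ∈⟨_⟩) (comm w z)
                 (factor-∈⟨product⟩ w z w^s≡ε z^r≡ε (distinctPrimes⇒coprime ps pr (λ s≡r → r≢s (sym s≡r))))
      zw≢ε : z ∙ w ≢ ε
      zw≢ε zw≡ε with z∈⟨zw⟩
      ... | m , zw^m≡z = z≢ε (trans (sym zw^m≡z) (trans (cong (_^ᴳ m) zw≡ε) (ε-^ᴳ m)))

    -- Given nontrivial a, c of distinct prime orders p, q, every nontrivial x is
    -- joined to a: a power z of x has prime order r, and z reaches a directly if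
    -- r ≠ p, and via c otherwise.
    twoPrimeOrders⇒connected : ∀ {p q} a c → Prime p → Prime q → p ≢ q → a ^ᴳ p ≡ ε → c ^ᴳ q ≡ ε →
                               a ≢ ε → c ≢ ε → ∀ x y → x ≢ ε → y ≢ ε → Path S x y
    twoPrimeOrders⇒connected {p} {q} a c pp pq p≢q a^p≡ε c^q≡ε a≢ε c≢ε x y x≢ε y≢ε =
      path-++ (to-a x x≢ε) (path-reverse powerAdj-sym (to-a y y≢ε))
      where
      to-a : ∀ x → x ≢ ε → Path S x a
      to-a x x≢ε with primeDivisor (order x) (order≥2 x x≢ε)
      ... | r , pr , r∣o with elementOfOrderDividing x r (prime>1 pr) r∣o
      ...   | k , z≢ε , z^r≡ε with r ≟ p
      ...     | no r≢p = path-++ (power-path (^ᴳ-∈⟨⟩ x k) x≢ε z≢ε)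
                           (distinctPrimeOrders-path _ a pr pp r≢p z^r≡ε a^p≡ε z≢ε a≢ε)
      ...     | yes refl = path-++ (power-path (^ᴳ-∈⟨⟩ x k) x≢ε z≢ε)
                           (path-++ (distinctPrimeOrders-path _ c pr pq p≢q z^r≡ε c^q≡ε z≢ε c≢ε)
                                    (distinctPrimeOrders-path c a pq pr (λ q≡p → p≢q (sym q≡p))
                                       c^q≡ε a^p≡ε c≢ε a≢ε))

  noEmptyCut : ∀ S → ∣ S ∣ < 1 → ¬ DisconnectedAfterRemoving (PowerAdj G) S
  noEmptyCut S |S|<1 = connected⇒¬disconnected
    (ε∉S⇒connected S (λ ε∈S → <⇒≱ |S|<1 (member⇒size≥1 ε∈S)))

  -- If two distinct primes divide n, no single vertex disconnects P(G): removing
  -- ε keeps the other vertices connected through elements of orders p and q (Cauchy).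
  twoPrimes⇒noCutVertex : ∀ {p q} → Prime p → Prime q → p ≢ q → p ∣ n → q ∣ n →
                          ∀ S → ∣ S ∣ ≡ 1 → ¬ DisconnectedAfterRemoving (PowerAdj G) S
  twoPrimes⇒noCutVertex {p} {q} pp pq p≢q p∣n q∣n S |S|≡1 with ε ∈? S
  ... | no ε∉S = connected⇒¬disconnected (ε∉S⇒connected S ε∉S)
  ... | yes ε∈S with cauchy p pp p∣n | cauchy q pq q∣n
  ...   | a , a≢ε , a^p≡ε | c , c≢ε , c^q≡ε = connected⇒¬disconnected connected
    where
    nontrivial∉S : ∀ x → x ≢ ε → x ∉ S
    nontrivial∉S x x≢ε x∈S = <⇒≱ (n<1+n 1) (subst (2 ≤_) |S|≡1 (members⇒size≥2 x∈S ε∈S x≢ε))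
    ∉S⇒≢ε : ∀ {x} → x ∉ S → x ≢ ε
    ∉S⇒≢ε x∉S x≡ε = x∉S (subst (_∈ S) (sym x≡ε) ε∈S)
    connected : ConnectedAfterRemoving
    connected u v u∉S v∉S = RemovingOnlyε.twoPrimeOrders⇒connected S nontrivial∉S a c pp pq p≢q
      a^p≡ε c^q≡ε a≢ε c≢ε u v (∉S⇒≢ε u∉S) (∉S⇒≢ε v∉S)

  -- Let p ^ (s+1) be
  -- the exponent of G and g an element with a = g ^ p ^ s ≠ ε, so a has order p.
  -- Along paths avoiding ε the property "a is a power of x" is preserved, because
  -- a cyclic group has only one subgroup of order p; it holds at a, but fails at
  -- some b ∉ ⟨ g ⟩ of order p.
  module NonCyclicPGroup (p r : ℕ) (pp : Prime p) (n≡p^r : n ≡ p ^ r) (noncyclic : ¬ IsCyclic G) where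

    ^ᴳ-p^r : ∀ x → x ^ᴳ (p ^ r) ≡ ε
    ^ᴳ-p^r x = subst (λ m → x ^ᴳ m ≡ ε) n≡p^r (^ᴳ-order-of-G x)

    exponentWitness : ∀ k → (∀ x → x ^ᴳ (p ^ k) ≡ ε) →
                      ∃ λ s → (∀ x → x ^ᴳ (p ^ suc s) ≡ ε) × ∃ λ g → g ^ᴳ (p ^ s) ≢ ε
    exponentWitness zero trivial = ⊥-elim (noncyclic (ε , λ x → 0 , sym (trans (sym (^ᴳ-1 x)) (trivial x))))
    exponentWitness (suc k) killed with all? (λ x → x ^ᴳ (p ^ k) ≟ᶠ ε)
    ... | yes killed' = exponentWitness k killed'
    ... | no ¬killed' with ¬∀⟶∃¬ n _ (λ x → x ^ᴳ (p ^ k) ≟ᶠ ε) ¬killed'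
    ...   | g , g^pᵏ≢ε = k , killed , g , g^pᵏ≢ε

    primeOrderPower : ∀ w → w ≢ ε → ∃ λ z → z ∈⟨ w ⟩ × z ≢ ε × z ^ᴳ p ≡ ε
    primeOrderPower w w≢ε with firstSwitch (_≡ ε) (_≟ᶠ ε) (λ k → w ^ᴳ (p ^ k)) r
                                 (λ w^1≡ε → w≢ε (trans (sym (^ᴳ-1 w)) w^1≡ε)) (^ᴳ-p^r w)
    ... | k , z≢ε , z^p≡ε = w ^ᴳ (p ^ k) , ^ᴳ-∈⟨⟩ w (p ^ k) , z≢ε , trans (sym (^ᴳ-* w p (p ^ k))) z^p≡ε

    powerOfOrderP-step : ∀ {a u w} → a ^ᴳ p ≡ ε → PowerAdj G u w → w ≢ ε → a ∈⟨ u ⟩ → a ∈⟨ w ⟩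
    powerOfOrderP-step a^p≡ε (_ , inj₂ u∈⟨w⟩) _ a∈⟨u⟩ = ∈⟨⟩-trans a∈⟨u⟩ u∈⟨w⟩
    powerOfOrderP-step {a} {u} a^p≡ε (_ , inj₁ w∈⟨u⟩) w≢ε a∈⟨u⟩ with primeOrderPower _ w≢ε
    ... | z , z∈⟨w⟩ , z≢ε , z^p≡ε = ∈⟨⟩-trans
          (uniquePrimeOrderSubgroup u a z pp a∈⟨u⟩ (∈⟨⟩-trans z∈⟨w⟩ w∈⟨u⟩) a^p≡ε z^p≡ε z≢ε) z∈⟨w⟩

    powerOfOrderP-invariant : ∀ {a x y} → a ^ᴳ p ≡ ε → Path ⁅ ε ⁆ x y → a ∈⟨ x ⟩ → a ∈⟨ y ⟩
    powerOfOrderP-invariant a^p≡ε (here _) a∈⟨x⟩ = a∈⟨x⟩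
    powerOfOrderP-invariant a^p≡ε (step _ adj rest) a∈⟨x⟩ = powerOfOrderP-invariant a^p≡ε rest
      (powerOfOrderP-step a^p≡ε adj (x∉⁅y⁆⇒x≢y (path-start∉ rest)) a∈⟨x⟩)

    module _ (s : ℕ) (exponent : ∀ x → x ^ᴳ (p ^ suc s) ≡ ε) where

      p^s-power-killedBy-p : ∀ g → (g ^ᴳ (p ^ s)) ^ᴳ p ≡ ε
      p^s-power-killedBy-p g = trans (sym (^ᴳ-* g p (p ^ s))) (exponent g)

      p^s-power-killedBy-j : ∀ g h j → g ^ᴳ j ≡ h ^ᴳ p → (g ^ᴳ (p ^ s)) ^ᴳ j ≡ ε
      p^s-power-killedBy-j g h j g^j≡hᵖ = begin
        (g ^ᴳ (p ^ s)) ^ᴳ j     ≡⟨ sym (^ᴳ-* g j (p ^ s)) ⟩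
        g ^ᴳ (j * p ^ s)       ≡⟨ ^ᴳ-*ʳ g j (p ^ s) ⟩
        (g ^ᴳ j) ^ᴳ (p ^ s)     ≡⟨ cong (_^ᴳ (p ^ s)) g^j≡hᵖ ⟩
        (h ^ᴳ p) ^ᴳ (p ^ s)     ≡⟨ sym (^ᴳ-*ʳ h p (p ^ s)) ⟩
        h ^ᴳ (p ^ suc s)       ≡⟨ exponent h ⟩
        ε                      ∎

      -- If g ^ p ^ s ≠ ε, some b ∉ ⟨ g ⟩ has b ^ p = ε: take h ∉ ⟨ g ⟩ with
      -- h ^ p = g ^ j ∈ ⟨ g ⟩; then p ∣ j and b = h ∙ (g ^ (j / p))⁻¹.
      outsideOfOrderP : ∀ g → g ^ᴳ (p ^ s) ≢ ε → ∃ λ b → ¬ b ∈⟨ g ⟩ × b ^ᴳ p ≡ ε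
      outsideOfOrderP g a≢ε with ¬∀⟶∃¬ n (_∈⟨ g ⟩) (_∈⟨ g ⟩?) (λ all → noncyclic (g , all))
      ... | h₀ , h₀∉⟨g⟩ with firstSwitch (_∈⟨ g ⟩) (_∈⟨ g ⟩?) (λ i → h₀ ^ᴳ (p ^ i)) (suc s)
                               (λ h₀∈ → h₀∉⟨g⟩ (subst (_∈⟨ g ⟩) (^ᴳ-1 h₀) h₀∈)) (0 , sym (exponent h₀))
      ...   | i , h∉⟨g⟩ , (j , g^j≡hᵖ) = correct (h₀ ^ᴳ (p ^ i)) j h∉⟨g⟩ (trans g^j≡hᵖ (^ᴳ-* h₀ p (p ^ i)))
        where
        correct : ∀ h j → ¬ h ∈⟨ g ⟩ → g ^ᴳ j ≡ h ^ᴳ p → ∃ λ b → ¬ b ∈⟨ g ⟩ × b ^ᴳ p ≡ ε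
        correct h j h∉⟨g⟩ g^j≡hᵖ
          with primeOrder-∣ (g ^ᴳ (p ^ s)) j pp (p^s-power-killedBy-p g) a≢ε (p^s-power-killedBy-j g h j g^j≡hᵖ)
        ... | divides j′ refl = _ , correctOutside p h∉⟨g⟩ (^ᴳ-∈⟨⟩ g j′)
                                      (sym (trans (sym (^ᴳ-*ʳ g j′ p)) g^j≡hᵖ))

    ε-isCutVertex : DisconnectedAfterRemoving (PowerAdj G) ⁅ ε ⁆
    ε-isCutVertex with exponentWitness r ^ᴳ-p^r
    ... | s , exponent , g , a≢ε with outsideOfOrderP s exponent g a≢ε
    ...   | b , b∉⟨g⟩ , b^p≡ε =
      a , b , x≢y⇒x∉⁅y⁆ a≢ε , x≢y⇒x∉⁅y⁆ b≢ε ,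
      λ path → a∉⟨b⟩ (powerOfOrderP-invariant a^p≡ε path (∈⟨⟩-refl a))
      where
      a : Fin n
      a = g ^ᴳ (p ^ s)
      a^p≡ε : a ^ᴳ p ≡ ε
      a^p≡ε = p^s-power-killedBy-p s exponent g
      b≢ε : b ≢ ε
      b≢ε b≡ε = b∉⟨g⟩ (0 , sym b≡ε)
      -- a = b ^ t with p ∤ t (as a ≠ ε) would give b ∈ ⟨ a ⟩ ⊆ ⟨ g ⟩
      a∉⟨b⟩ : ¬ a ∈⟨ b ⟩
      a∉⟨b⟩ (t , b^t≡a) = b∉⟨g⟩ (∈⟨⟩-trans
          (subst (b ∈⟨_⟩) b^t≡a (coprimePower-generates b t b^p≡ε (prime∤⇒coprime pp p∤t)))
          (^ᴳ-∈⟨⟩ g (p ^ s)))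
        where
        p∤t : ¬ p ∣ t
        p∤t (divides q refl) = a≢ε (trans (sym b^t≡a) (^ᴳ-multiple b q b^p≡ε))

nonCyclic⇒order≥2 : ∀ {n} (G : FinGroup n) → ¬ IsCyclic G → 2 ≤ n
nonCyclic⇒order≥2 {zero} G _ = ⊥-elim (¬Fin0 (FinGroup.ε G))
nonCyclic⇒order≥2 {suc zero} G noncyclic = ⊥-elim (noncyclic (FinGroup.ε G , λ x → 0 , singleton _ x))
  where
  singleton : (x y : Fin 1) → x ≡ y
  singleton fzero fzero = refl
nonCyclic⇒order≥2 {suc (suc _)} _ _ = s≤s (s≤s z≤n)

mainTheorem19 : (n : ℕ) (G : FinGroup n) → IsAbelian G → ¬ IsCyclic G →
    (VertexConnectivityIs (PowerAdj G) 1 ⇔ IsPGroupOrder n)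
mainTheorem19 n G comm noncyclic = mk⇔ κ≡1⇒pGroup pGroup⇒κ≡1
  where
  open FinGroup G
  open PowerGraph G comm

  κ≡1⇒pGroup : VertexConnectivityIs (PowerAdj G) 1 → IsPGroupOrder n
  κ≡1⇒pGroup ((S , |S|≡1 , disconnected) , _)
    with primePowerOrTwoPrimes n (nonCyclic⇒order≥2 G noncyclic)
  ... | inj₁ pGroup = pGroup
  ... | inj₂ (p , q , pp , pq , p≢q , p∣n , q∣n) =
        ⊥-elim (twoPrimes⇒noCutVertex pp pq p≢q p∣n q∣n S |S|≡1 disconnected)

  pGroup⇒κ≡1 : IsPGroupOrder n → VertexConnectivityIs (PowerAdj G) 1
  pGroup⇒κ≡1 (p , r , pp , _ , n≡p^r) =
    (⁅ ε ⁆ , ∣⁅x⁆∣≡1 ε , NonCyclicPGroup.ε-isCutVertex p r pp n≡p^r noncyclic) , noEmptyCut
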